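{- Let $\alpha\in\{+,-\}$ and let $G$ be an almost strong $\alpha$-radial with root $r$. If $V(G)\setminus\{r\}\neq\emptyset$, then $\delta_G(r)$ contains an edge $e$ in which the sign of $r$ is $-\alpha$. Furthermore, for any such $e$, there is a $-\alpha$-scoop diear relative to $r$ whose grip is $e$, and this diear has no vertex term denoting $r$ other than its first and last terms.
   Context: A bidirected graph $G$ is a finite graph (loops and parallel edges allowed) with maps $\partial_+,\partial_-:E(G)\to 2^{V(G)}$ such that for each edge $e$ with (possibly identical) ends $u,v$: $\partial_\alpha(e)\subseteq\{u,v\}$, $\partial_+(e)\cup\partial_-(e)=\{u,v\}$, and $\partial_+(e)\cap\partial_-(e)=\emptyset$ if $e$ is not a loop. If $u\in\partial_\alpha(e)$, the sign of $u$ over $e$ is $\alpha$; $-\alpha$ denotes the opposite sign. $\delta_G(X)$ is the set of edges joining $X$ and $V(G)\setminus X$. A walk is a sequence $W=(w_1,\dots,w_k)$, $k$ odd, with $w_i$ a vertex for odd $i$ and $w_i$ an edge joining $w_{i-1},w_{i+1}$ for even $i$ (the entries are its terms; odd-indexed ones are vertex terms); closed over $r$ if $w_1=w_k=r$; a trail has no repeated edge. $W$ is a diwalk if to each traversal of an edge $w_i$ one can assign signs to its end-occurrences equal to the signs of these vertices over $w_i$ (for a loop with one end $+$ and one end $-$, the two assigned signs are distinct), such that at every internal vertex term the signs assigned from the preceding and following edges are distinct. A ditrail is a diwalk that is a trail. For $k\ge3$ the sign of $w_1$ (resp. $w_k$) over $W$ is the sign assigned at $w_2$ (resp. $w_{k-1}$);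 $W$ is an $(\alpha,\beta)$-ditrail if these are $\alpha,\beta$; the trivial ditrail $(v)$ counts as both a $(+,-)$- and a $(-,+)$-ditrail. $G$ is an $\alpha$-radial with root $r$ if every $v$ has an $(\alpha,-\alpha)$-ditrail from $v$ to $r$; it is almost strong if every $v\in V(G)\setminus\{r\}$ has a $(-\alpha,-\alpha)$-ditrail from $v$ to $r$, but $G$ has no $(-\alpha,-\alpha)$-ditrail closed over $r$. A scoop diear relative to $r$ is a diwalk of the form $(r,e,w_3,\dots,w_{k-2},e,r)$ with $k\ge7$, where $e\in\delta_G(r)$ and $(w_3,\dots,w_{k-2})$ is a closed ditrail not containing $e$; $e$ is its grip, and it is a $\beta$-scoop diear if the sign of $r$ over $e$ is $\beta$. -}

module Defs where

open import Data.Nat using (ℕ)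
open import Data.Fin using (Fin)
open import Data.Bool using (Bool; true; false)
open import Data.List using (List; []; _∷_; map; _++_)
open import Data.List.Membership.Propositional using (_∈_)
open import Data.List.Relation.Unary.Unique.Propositional using (Unique)
open import Data.Product using (Σ; ∃; _×_; _,_; proj₁; proj₂)
open import Data.Sum using (_⊎_)
open import Data.Unit using (⊤)
open import Data.Empty using (⊥)
open import Relation.Nullary using (¬_)
open import Relation.Binary.PropositionalEquality using (_≡_; _≢_)

data Sign : Set where
  ⊕ ⊖ : Sign

-_ : Sign → Sign
- ⊕ = ⊖
- ⊖ = ⊕

-- Bidirected graphs (finite; loops and parallel edges allowed).
-- Vertices are Fin nV, edges Fin nE; each edge e has ends end₁ e, end₂ e
-- (possibly identical).  ∂ α e v ≡ true  means  v ∈ ∂_α(e).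

record BiGraph : Set where
  field
    nV nE : ℕ
    end₁ end₂ : Fin nE → Fin nV
    ∂ : Sign → Fin nE → Fin nV → Bool
    ∂-sub : ∀ α e v → ∂ α e v ≡ true → (v ≡ end₁ e ⊎ v ≡ end₂ e)
    ∂-cover : ∀ e v → (v ≡ end₁ e ⊎ v ≡ end₂ e) → (∂ ⊕ e v ≡ true ⊎ ∂ ⊖ e v ≡ true)
    ∂-disj : ∀ e → end₁ e ≢ end₂ e → ∀ v → ¬ (∂ ⊕ e v ≡ true × ∂ ⊖ e v ≡ true)

module _ (G : BiGraph) where
  open BiGraph G

  V E : Set
  V = Fin nV
  E = Fin nE

  IsLoop : E → Set
  IsLoop e = end₁ e ≡ end₂ e

  Joins : E → V → V → Set
  Joins e u v = (u ≡ end₁ e × v ≡ end₂ e) ⊎ (u ≡ end₂ e × v ≡ end₁ e)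

  Inδ : V → E → Set
  Inδ r e = Σ V λ v → v ≢ r × Joins e r v

  -- Walks  W = (w₁, e₁, w₃, e₂, …, w_k), represented by the first vertex
  -- and the list of (edge, next vertex) pairs.

  record Walk : Set where
    constructor walk
    field
      start : V
      steps : List (E × V)

  lastV : V → List (E × V) → V
  lastV u [] = u
  lastV u ((e , v) ∷ ss) = lastV v ss

  finish : Walk → V
  finish (walk u ss) = lastV u ss

  IsWalkFrom : V → List (E × V) → Set
  IsWalkFrom u [] = ⊤
  IsWalkFrom u ((e , v) ∷ ss) = Joins e u v × IsWalkFrom v ss

  IsWalk : Walk → Set
  IsWalk (walk u ss) = IsWalkFrom u ss

  innerVerts : List (E × V) → List V
  innerVerts [] = []
  innerVerts ((e , v) ∷ []) = []
  innerVerts ((e , v) ∷ s ∷ ss) = v ∷ innerVerts (s ∷ ss)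

  IsTrail : Walk → Set
  IsTrail W = IsWalk W × Unique (map proj₁ (Walk.steps W))

  -- Sign assignments for traversals.  A signed step (a , e , b , v)
  -- traverses e from the current vertex u to v, assigning sign a to the
  -- occurrence of u and sign b to the occurrence of v.

  SStep : Set
  SStep = Sign × E × Sign × V

  erase : List SStep → List (E × V)
  erase [] = []
  erase ((a , e , b , v) ∷ ss) = (e , v) ∷ erase ss

  StepOK : V → SStep → Set
  StepOK u (a , e , b , v) =
    ∂ a e u ≡ true × ∂ b e v ≡ true ×
    (IsLoop e → ∂ ⊕ e u ≡ true → ∂ ⊖ e u ≡ true → a ≢ b)

  Link : SStep → List SStep → Set
  Link s [] = ⊤
  Link (a , e , b , v) ((a' , e' , b' , v') ∷ ss) = b ≢ a'

  SignedOK : V → List SStep → Set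
  SignedOK u [] = ⊤
  SignedOK u ((a , e , b , v) ∷ ss) =
    StepOK u (a , e , b , v) × Link (a , e , b , v) ss × SignedOK v ss

  DiAssignment : Walk → List SStep → Set
  DiAssignment (walk u ss) σ = erase σ ≡ ss × SignedOK u σ

  IsDiwalk : Walk → Set
  IsDiwalk W = IsWalk W × Σ (List SStep) (DiAssignment W)

  firstSign : SStep → List SStep → Sign
  firstSign (a , e , b , v) ss = a

  lastSign : SStep → List SStep → Sign
  lastSign (a , e , b , v) [] = b
  lastSign s (s' ∷ ss) = lastSign s' ss

  -- W is an (α,β)-ditrail (the trivial ditrail is both a (+,-)- and a
  -- (-,+)-ditrail)
  IsDitrailαβ : Sign → Sign → Walk → Set
  IsDitrailαβ α β W =
    IsTrail W ×
    ( (Walk.steps W ≡ [] × ((α ≡ ⊕ × β ≡ ⊖) ⊎ (α ≡ ⊖ × β ≡ ⊕)))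
    ⊎ Σ SStep λ s → Σ (List SStep) λ σ →
        DiAssignment W (s ∷ σ) × firstSign s σ ≡ α × lastSign s σ ≡ β )

  DitrailFromTo : Sign → Sign → V → V → Set
  DitrailFromTo α β v r =
    Σ Walk λ W → Walk.start W ≡ v × finish W ≡ r × IsDitrailαβ α β W

  IsRadial : Sign → V → Set
  IsRadial α r = ∀ (v : V) → DitrailFromTo α (- α) v r

  IsAlmostStrong : Sign → V → Set
  IsAlmostStrong α r =
    (∀ (v : V) → v ≢ r → DitrailFromTo (- α) (- α) v r) ×
    ¬ DitrailFromTo (- α) (- α) r r

  -- Scoop diears:  W = (r, e, w₃, …, w_{k-2}, e, r), k ≥ 7, e ∈ δ_G(r),
  -- (w₃,…,w_{k-2}) a closed ditrail not containing e; β-scoop if the sign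
  -- of r over e is β.

  IsScoopDiear : V → Sign → E → Walk → Set
  IsScoopDiear r β e W =
    Σ V λ x → Σ (E × V) λ s → Σ (List (E × V)) λ inner →
      W ≡ walk r ((e , x) ∷ s ∷ inner ++ ((e , r) ∷ [])) ×
      IsDiwalk W ×
      Inδ r e ×
      IsTrail (walk x (s ∷ inner)) ×
      IsDiwalk (walk x (s ∷ inner)) ×
      lastV x (s ∷ inner) ≡ x ×
      ¬ (e ∈ map proj₁ (s ∷ inner)) ×
      ∂ β e r ≡ true

module Submission where

-- The whole proof rests on
-- one observation, the FIRST-ARRIVAL LEMMA: a ditrail from u ≠ r to r whose
-- sign at r is -α already reaches r with sign -α the first time it meets r.
-- Otherwise it leaves r again with sign -α (signs alternate at internal
-- vertices) and its remainder is a (-α,-α)-ditrail closed over r, which an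
-- almost strong radial does not have.
--
-- (1) Applied to a (-α,-α)-ditrail from some v ≠ r, the edge of the first
--     arrival lies in δ(r) and has sign -α at r.
-- (2) For a grip e ∈ δ(r) with sign -α at r, other end x and sign γ at x,
--     take a (-γ,-α)-ditrail from x to r (almost strong if γ = α, radial
--     if γ = -α) and cut it at its first arrival.  Prefixing e gives a walk
--     r → r; it is not a closed (-α,-α)-ditrail, so the arrival edge is e
--     itself and the part from x back to x is the closed inner ditrail of a
--     -α-scoop diear with grip e, which meets r only at its two ends.

open import Defs
open import Data.Bool using (true)
open import Data.List using (List; []; _∷_; map; _++_)
open import Data.List.Properties using (map-++)
open import Data.List.Membership.Propositional using (_∉_)
open import Data.List.Relation.Unary.All as All using (All; []; _∷_)
open import Data.List.Relation.Unary.All.Properties using (All¬⇒¬Any; ++⁺; ++⁻ˡ)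
open import Data.List.Relation.Unary.AllPairs using ([]; _∷_)
open import Data.List.Relation.Unary.Unique.Propositional using (Unique)
open import Data.Product using (Σ; _×_; _,_; proj₁; proj₂)
open import Data.Sum using (_⊎_; inj₁; inj₂)
open import Data.Unit using (tt)
open import Data.Empty using (⊥; ⊥-elim)
open import Data.Fin.Properties using (_≟_)
open import Relation.Nullary using (¬_; Dec; yes; no)
open import Relation.Binary.PropositionalEquality
  using (_≡_; _≢_; refl; sym; trans; cong; subst; ≢-sym)

_≟ˢ_ : (β γ : Sign) → Dec (β ≡ γ)
⊕ ≟ˢ ⊕ = yes refl
⊕ ≟ˢ ⊖ = no (λ ())
⊖ ≟ˢ ⊕ = no (λ ())
⊖ ≟ˢ ⊖ = yes refl

sign≢opposite : ∀ γ → γ ≢ - γ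
sign≢opposite ⊕ ()
sign≢opposite ⊖ ()

≢⇒opposite : ∀ {γ δ} → γ ≢ δ → δ ≡ - γ
≢⇒opposite {⊕} {⊕} γ≢δ = ⊥-elim (γ≢δ refl)
≢⇒opposite {⊕} {⊖} _ = refl
≢⇒opposite {⊖} {⊕} _ = refl
≢⇒opposite {⊖} {⊖} γ≢δ = ⊥-elim (γ≢δ refl)

module _ (G : BiGraph) where
  open BiGraph G

  edges : List (SStep G) → List (E G)
  edges σ = map proj₁ (erase G σ)

  verts : List (SStep G) → List (V G)
  verts σ = map proj₂ (erase G σ)

  endV : V G → List (SStep G) → V G
  endV u σ = lastV G u (erase G σ)

  erase-++ : ∀ xs ys → erase G (xs ++ ys) ≡ erase G xs ++ erase G ys
  erase-++ [] ys = refl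
  erase-++ ((a , e , b , v) ∷ xs) ys = cong ((e , v) ∷_) (erase-++ xs ys)

  edges-++ : ∀ xs ys → edges (xs ++ ys) ≡ edges xs ++ edges ys
  edges-++ xs ys = trans (cong (map proj₁) (erase-++ xs ys)) (map-++ proj₁ (erase G xs) (erase G ys))

  endV-snoc : ∀ u xs a f b v → endV u (xs ++ (a , f , b , v) ∷ []) ≡ v
  endV-snoc u [] a f b v = refl
  endV-snoc u ((_ , _ , _ , w) ∷ xs) a f b v = endV-snoc w xs a f b v

  lastSign-snoc : ∀ t xs a f b v → lastSign G t (xs ++ (a , f , b , v) ∷ []) ≡ b
  lastSign-snoc t [] a f b v = refl
  lastSign-snoc t (x ∷ xs) a f b v = lastSign-snoc x xs a f b v

  innerVerts-snoc : ∀ {P : V G → Set} ys z → All P (map proj₂ ys) → All P (innerVerts G (ys ++ z ∷ []))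
  innerVerts-snoc [] z _ = []
  innerVerts-snoc (y ∷ []) z (p ∷ []) = p ∷ []
  innerVerts-snoc (y ∷ y' ∷ ys) z (p ∷ ps) = p ∷ innerVerts-snoc (y' ∷ ys) z ps

  record SignedTrail (u : V G) (σ : List (SStep G)) : Set where
    constructor mkTrail
    field
      walks    : IsWalkFrom G u (erase G σ)
      distinct : Unique (edges σ)
      signed   : SignedOK G u σ
  open SignedTrail

  link-prefix : ∀ t xs ys → Link G t (xs ++ ys) → Link G t xs
  link-prefix t [] ys _ = tt
  link-prefix t (x ∷ xs) ys l = l

  prefix : ∀ {u} xs ys → SignedTrail u (xs ++ ys) → SignedTrail u xs
  prefix [] ys _ = mkTrail tt [] tt
  prefix ((a , f , b , v) ∷ xs) ys (mkTrail (j , w) (fresh ∷ d) (st , l , s)) =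
    mkTrail (j , walks T) (fresh' ∷ distinct T) (st , link-prefix _ xs ys l , signed T)
    where
      T = prefix xs ys (mkTrail w d s)
      fresh' = ++⁻ˡ (edges xs) (subst (All (f ≢_)) (edges-++ xs ys) fresh)

  suffix : ∀ {u} xs ys → SignedTrail u (xs ++ ys) → SignedTrail (endV u xs) ys
  suffix [] ys T = T
  suffix ((a , f , b , v) ∷ xs) ys (mkTrail (_ , w) (_ ∷ d) (_ , _ , s)) = suffix xs ys (mkTrail w d s)

  record SignedDitrail (β γ : Sign) (u v : V G) : Set where
    constructor signedDitrail
    field
      first : SStep G
      rest  : List (SStep G)
      trail : SignedTrail u (first ∷ rest)
      ends  : endV u (first ∷ rest) ≡ v
      firstSigned : firstSign G first rest ≡ β
      lastSigned  : lastSign G first rest ≡ γ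

  fromDitrail : ∀ {β γ u v} → DitrailFromTo G β γ u v → u ≢ v → SignedDitrail β γ u v
  fromDitrail (walk _ _ , refl , fin , _ , inj₁ (refl , _)) u≢v = ⊥-elim (u≢v fin)
  fromDitrail (walk _ _ , refl , fin , (w , d) , inj₂ (s , σ , (refl , sg) , fs , ls)) _ =
    signedDitrail s σ (mkTrail w d sg) fin fs ls

  toDitrail : ∀ {β γ u v} → SignedDitrail β γ u v → DitrailFromTo G β γ u v
  toDitrail {u = u} (signedDitrail s σ T fin fs ls) =
    walk u (erase G (s ∷ σ)) , refl , fin , (walks T , distinct T) , inj₂ (s , σ , (refl , signed T) , fs , ls)

  someSign : ∀ {e u x} → Joins G e u x → Σ Sign (λ γ → ∂ γ e x ≡ true)
  someSign {e} {x = x} j with ∂-cover e x (other-end j)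
    where
      other-end : ∀ {e u x} → Joins G e u x → x ≡ end₁ e ⊎ x ≡ end₂ e
      other-end (inj₁ (_ , x≡)) = inj₂ x≡
      other-end (inj₂ (_ , x≡)) = inj₁ x≡
  ... | inj₁ d = ⊕ , d
  ... | inj₂ d = ⊖ , d

  opposite-signs : ∀ {e x} γ → end₁ e ≢ end₂ e → ∂ γ e x ≡ true → ∂ (- γ) e x ≡ true → ⊥
  opposite-signs {e} {x} ⊕ nl p q = ∂-disj e nl x (p , q)
  opposite-signs {e} {x} ⊖ nl p q = ∂-disj e nl x (q , p)

  joins-sym : ∀ {e p q} → Joins G e p q → Joins G e q p
  joins-sym (inj₁ (p≡ , q≡)) = inj₂ (q≡ , p≡)
  joins-sym (inj₂ (p≡ , q≡)) = inj₁ (q≡ , p≡)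

  module _ (r : V G) where

    non-loop : ∀ {e x} → Joins G e r x → x ≢ r → end₁ e ≢ end₂ e
    non-loop (inj₁ (r≡ , x≡)) x≢r loop = x≢r (trans x≡ (trans (sym loop) (sym r≡)))
    non-loop (inj₂ (r≡ , x≡)) x≢r loop = x≢r (trans x≡ (trans loop (sym r≡)))

    other-end-unique : ∀ {e x w} → Joins G e r x → Joins G e w r → w ≢ r → w ≡ x
    other-end-unique (inj₁ (r≡ , _)) (inj₁ (w≡ , _)) w≢r = ⊥-elim (w≢r (trans w≡ (sym r≡)))
    other-end-unique (inj₂ (_ , x≡)) (inj₁ (w≡ , _)) _ = trans w≡ (sym x≡)
    other-end-unique (inj₁ (_ , x≡)) (inj₂ (w≡ , _)) _ = trans w≡ (sym x≡)
    other-end-unique (inj₂ (r≡ , _)) (inj₂ (w≡ , _)) w≢r = ⊥-elim (w≢r (trans w≡ (sym r≡)))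

    not-between : ∀ {e x p q} → Joins G e r x → Joins G e p q → p ≢ r → q ≢ r → ⊥
    not-between (inj₁ (r≡ , _)) (inj₁ (p≡ , _)) p≢r _ = p≢r (trans p≡ (sym r≡))
    not-between (inj₁ (r≡ , _)) (inj₂ (_ , q≡)) _ q≢r = q≢r (trans q≡ (sym r≡))
    not-between (inj₂ (r≡ , _)) (inj₁ (_ , q≡)) _ q≢r = q≢r (trans q≡ (sym r≡))
    not-between (inj₂ (r≡ , _)) (inj₂ (p≡ , _)) p≢r _ = p≢r (trans p≡ (sym r≡))

    avoids-edges-at-root : ∀ {e x u} σ → Joins G e r x → u ≢ r → IsWalkFrom G u (erase G σ) →
      All (_≢ r) (verts σ) → All (e ≢_) (edges σ)
    avoids-edges-at-root [] _ _ _ _ = []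
    avoids-edges-at-root ((_ , f , _ , v) ∷ σ) j u≢r (jf , w) (v≢r ∷ avoids) =
      (λ { refl → not-between j jf u≢r v≢r }) ∷ avoids-edges-at-root σ j v≢r w avoids

    endV-avoids : ∀ {u} σ → u ≢ r → All (_≢ r) (verts σ) → endV u σ ≢ r
    endV-avoids [] u≢r _ = u≢r
    endV-avoids (_ ∷ σ) _ (v≢r ∷ avoids) = endV-avoids σ v≢r avoids

    record FirstArrival (α : Sign) (L : List (SStep G)) : Set where
      constructor arrival
      field
        pre    : List (SStep G)
        sign   : Sign
        edge   : E G
        post   : List (SStep G)
        splits : L ≡ (pre ++ (sign , edge , - α , r) ∷ []) ++ post
        avoids : All (_≢ r) (verts pre)

    firstArrival : ∀ {α u} → ¬ DitrailFromTo G (- α) (- α) r r → u ≢ r → ∀ s σ →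
      SignedTrail u (s ∷ σ) → endV u (s ∷ σ) ≡ r → lastSign G s σ ≡ - α → FirstArrival α (s ∷ σ)
    firstArrival _ _ (a , f , _ , _) [] _ refl refl = arrival [] a f [] refl []
    firstArrival {α} noClosed _ (a , f , b , v) (q ∷ σ) T fin ls with r ≟ v
    ... | no r≢v =
      let arrival pre a' f' post eq avoids = firstArrival noClosed (≢-sym r≢v) q σ (suffix (_ ∷ []) _ T) fin ls
      in arrival ((a , f , b , v) ∷ pre) a' f' post (cong (_ ∷_) eq) (≢-sym r≢v ∷ avoids)
    ... | yes refl with b ≟ˢ (- α)
    ...   | yes refl = arrival [] a f (q ∷ σ) refl []
    ...   | no b≢-α = ⊥-elim (noClosed (toDitrail (signedDitrail q σ (suffix (_ ∷ []) _ T) fin leaves ls)))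
      where
        -- leaving r again, the sign alternates from b to -α
        leaves : firstSign G q σ ≡ - α
        leaves = trans (≢⇒opposite (proj₁ (proj₂ (signed T)))) (sym (≢⇒opposite b≢-α))

    rootEdge : ∀ {α} → IsAlmostStrong G α r → Σ (V G) (λ v → v ≢ r) →
      Σ (E G) (λ e → Inδ G r e × ∂ (- α) e r ≡ true)
    rootEdge {α} (toRoot , noClosed) (v , v≢r) with fromDitrail (toRoot v v≢r) v≢r
    ... | signedDitrail s σ T fin _ ls with firstArrival noClosed v≢r s σ T fin ls
    ... | arrival pre a f post eq avoids =
      f , (endV v pre , endV-avoids pre v≢r avoids , joins-sym (proj₁ (walks atArrival))) ,
      proj₁ (proj₂ (proj₁ (signed atArrival)))
      where
        atArrival : SignedTrail (endV v pre) ((a , f , - α , r) ∷ [])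
        atArrival = suffix pre _ (prefix _ post (subst (SignedTrail v) eq T))

    ditrailToRoot : ∀ α γ {x} → IsRadial G α r → IsAlmostStrong G α r → x ≢ r →
      DitrailFromTo G (- γ) (- α) x r
    ditrailToRoot ⊕ ⊕ _ (toRoot , _) x≢r = toRoot _ x≢r
    ditrailToRoot ⊕ ⊖ radial _ _ = radial _
    ditrailToRoot ⊖ ⊕ radial _ _ = radial _
    ditrailToRoot ⊖ ⊖ _ (toRoot , _) x≢r = toRoot _ x≢r

    ScoopWithGrip : Sign → E G → Set
    ScoopWithGrip β e = Σ (Walk G) (λ W → IsScoopDiear G r β e W × r ∉ innerVerts G (Walk.steps W))

    module Grip {α} (noClosed : ¬ DitrailFromTo G (- α) (- α) r r)
                {e x γ} (j : Joins G e r x) (x≢r : x ≢ r)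
                (dr : ∂ (- α) e r ≡ true) (dx : ∂ γ e x ≡ true) where

      grip : SStep G
      grip = (- α , e , γ , x)

      gripOK : StepOK G r grip
      gripOK = dr , dx , λ loop _ _ → ⊥-elim (non-loop j x≢r loop)

      closeScoop : ∀ pre a f → All (_≢ r) (verts pre) →
        SignedTrail x (pre ++ (a , f , - α , r) ∷ []) → Link G grip (pre ++ (a , f , - α , r) ∷ []) →
        Joins G f (endV x pre) r → Dec (f ≡ e) → ScoopWithGrip (- α) e
      -- arriving through another edge, grip and P form a closed (-α,-α)-ditrail
      closeScoop pre a f avoids P link _ (no f≢e) =
        ⊥-elim (noClosed (toDitrail (signedDitrail grip _ closed (endV-snoc x pre a f _ r) refl
          (lastSign-snoc grip pre a f _ r))))
        where
          missesE : All (e ≢_) (edges (pre ++ (a , f , - α , r) ∷ []))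
          missesE = subst (All (e ≢_)) (sym (edges-++ pre _))
            (++⁺ (avoids-edges-at-root pre j x≢r (walks (prefix pre _ P)) avoids) (≢-sym f≢e ∷ []))
          closed : SignedTrail r (grip ∷ pre ++ (a , f , - α , r) ∷ [])
          closed = mkTrail (j , walks P) (missesE ∷ distinct P) (gripOK , link , signed P)
      -- returning along e directly would give x both signs over the non-loop e
      closeScoop [] a .e _ P link _ (yes refl) =
        ⊥-elim (opposite-signs _ (non-loop j x≢r) dx
          (subst (λ c → ∂ c e x ≡ true) (≢⇒opposite link) (proj₁ (proj₁ (signed P)))))
      -- otherwise grip, P without its last step, and e back to r form the scoop
      closeScoop pre@((_ , e₁ , _ , v₁) ∷ pre') a .e avoids P link joinF (yes refl) =
        walk r (erase G (grip ∷ P-steps)) ,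
        (x , (e₁ , v₁) , erase G pre' ,
          cong (λ z → walk r ((e , x) ∷ (e₁ , v₁) ∷ z)) (erase-++ pre' _) ,
          ((j , walks P) , _ , refl , (gripOK , link , signed P)) ,
          (x , x≢r , j) ,
          (walks inner , distinct inner) ,
          (walks inner , pre , refl , signed inner) ,
          other-end-unique j joinF (endV-avoids pre x≢r avoids) ,
          All¬⇒¬Any (avoids-edges-at-root pre j x≢r (walks inner) avoids) ,
          dr) ,
        subst (λ z → r ∉ innerVerts G ((e , x) ∷ z)) (sym (erase-++ pre _))
          (All¬⇒¬Any (All.map ≢-sym (innerVerts-snoc ((e , x) ∷ erase G pre) (e , r) (x≢r ∷ avoids))))
        where
          P-steps : List (SStep G)
          P-steps = pre ++ (a , e , - α , r) ∷ []
          inner : SignedTrail x pre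
          inner = prefix pre _ P

    scoopDiear : ∀ {α} → IsRadial G α r → IsAlmostStrong G α r →
      (e : E G) → Inδ G r e → ∂ (- α) e r ≡ true → ScoopWithGrip (- α) e
    scoopDiear {α} radial almostStrong@(_ , noClosed) e (x , x≢r , j) dr with someSign j
    ... | γ , dx with fromDitrail (ditrailToRoot α γ radial almostStrong x≢r) x≢r
    ... | signedDitrail s σ T fin fs ls with firstArrival noClosed x≢r s σ T fin ls
    ... | arrival pre a f post eq avoids =
      closeScoop pre a f avoids P (link-prefix grip _ post (subst (Link G grip) eq leavesRoot))
        (proj₁ (walks (suffix pre _ P))) (f ≟ e)
      where
        open Grip noClosed j x≢r dr dx
        P : SignedTrail x (pre ++ (a , f , - α , r) ∷ [])
        P = prefix _ post (subst (SignedTrail x) eq T)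
        -- its first sign -γ differs from the sign γ of x over the grip
        leavesRoot : Link G grip (s ∷ σ)
        leavesRoot γ≡ = sign≢opposite γ (trans γ≡ fs)

lemma10p9 : (G : BiGraph) (α : Sign) (r : V G) →
    IsRadial G α r → IsAlmostStrong G α r →
    Σ (V G) (λ v → v ≢ r) →
    Σ (E G) (λ e → Inδ G r e × BiGraph.∂ G (- α) e r ≡ true) ×
    ((e : E G) → Inδ G r e → BiGraph.∂ G (- α) e r ≡ true →
      Σ (Walk G) (λ W → IsScoopDiear G r (- α) e W ×
        r ∉ innerVerts G (Walk.steps W)))
lemma10p9 G α r radial almostStrong nonRoot =
  rootEdge G r almostStrong nonRoot , scoopDiear G r radial almostStrong
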